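{- A connected graph $G$ of order $n \geq 3$ satisfies $e_{cc}(G) = n-1$ if and only if $G \in \{K_3, P_3, C_{(n-1),1}\}$.
   Context: $C_{(n-1),1}$ denotes the connected unicyclic graph on $n$ vertices consisting of a cycle of order $n-1$ with one pendant vertex attached to a vertex of the cycle. Cycle convexity: for $S\subseteq V(G)$, a vertex $v\notin S$ is in the cycle interval of $S$ if $G[S\cup\{v\}]$ contains a cycle through $v$; $S$ is cycle convex if no vertex outside $S$ is in its cycle interval; $\langle S\rangle_{cc}$ is the smallest cycle convex set containing $S$. A nonempty set $S\subseteq V(G)$ is $E$-independent if $|S|=1$ or there exist $p\in S$ and $p'\in \langle S\setminus\{p\}\rangle_{cc}\setminus \bigcup_{a\in S\setminus\{p\}}\langle S\setminus\{a\}\rangle_{cc}$. The exchange number $e_{cc}(G)$ is the maximum cardinality of an $E$-independent set of $G$. -}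

module Defs where

open import Data.Bool using (Bool; true; false; not; _∧_; _∨_)
open import Data.Nat using (ℕ; zero; suc; _∸_; _≤_; _≡ᵇ_; _<ᵇ_)
open import Data.Fin using (Fin; toℕ)
open import Data.Fin.Subset using (Subset; _∈_; _∉_; _⊆_; _∪_; ⁅_⁆; _-_; ∣_∣; Nonempty)
open import Data.List using (List; []; _∷_; _++_; [_]; length)
open import Data.List.Relation.Unary.All using (All)
open import Data.List.Relation.Unary.Unique.Propositional using (Unique)
open import Data.Product using (Σ; ∃; ∃-syntax; _×_; _,_)
open import Data.Sum using (_⊎_)
open import Function.Bundles using (_↔_; Inverse)
open import Relation.Nullary using (¬_)
open import Relation.Binary.PropositionalEquality using (_≡_)

record Graph (n : ℕ) : Set where
  field
    adj    : Fin n → Fin n → Bool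
    sym    : ∀ x y → adj x y ≡ adj y x
    irrefl : ∀ x → adj x x ≡ false
open Graph public

module _ {n : ℕ} (G : Graph n) where

  data Walk : Fin n → Fin n → Set where
    here : ∀ {x} → Walk x x
    step : ∀ {x y z} → adj G x y ≡ true → Walk y z → Walk x z

  Connected : Set
  Connected = ∀ u v → Walk u v

  data Chain : Fin n → List (Fin n) → Set where
    []  : ∀ {x} → Chain x []
    _∷_ : ∀ {x y ys} → adj G x y ≡ true → Chain y ys → Chain x (y ∷ ys)

  CycleThroughIn : Subset n → Fin n → Set
  CycleThroughIn U v =
    ∃[ xs ] (2 ≤ length xs × v ∈ U × All (_∈ U) xs
             × Unique (v ∷ xs) × Chain v (xs ++ [ v ]))

  InCycleInterval : Subset n → Fin n → Set
  InCycleInterval S v = v ∉ S × CycleThroughIn (S ∪ ⁅ v ⁆) v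

  CycleConvex : Subset n → Set
  CycleConvex S = ∀ v → v ∉ S → ¬ InCycleInterval S v

  -- membership in ⟨S⟩_cc, the smallest cycle convex set containing S
  -- (= intersection of all cycle convex supersets of S)
  InHull : Subset n → Fin n → Set
  InHull S v = ∀ T → S ⊆ T → CycleConvex T → v ∈ T

  EIndependent : Subset n → Set
  EIndependent S =
    Nonempty S ×
    (∣ S ∣ ≡ 1 ⊎
     ∃[ p ] ∃[ p' ] (p ∈ S × InHull (S - p) p'
                     × (∀ a → a ∈ S → ¬ a ≡ p → ¬ InHull (S - a) p')))

  ExchangeNumber : ℕ → Set
  ExchangeNumber k =
    (∃[ S ] (EIndependent S × ∣ S ∣ ≡ k)) × (∀ S → EIndependent S → ∣ S ∣ ≤ k)

_≅_ : ∀ {n m} → Graph n → (Fin m → Fin m → Bool) → Set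
_≅_ {n} {m} G A =
  Σ (Fin n ↔ Fin m) λ f → ∀ x y → adj G x y ≡ A (Inverse.to f x) (Inverse.to f y)

K₃ : Fin 3 → Fin 3 → Bool
K₃ x y = not (toℕ x ≡ᵇ toℕ y)

-- P₃ : the path 0 − 1 − 2
P₃ : Fin 3 → Fin 3 → Bool
P₃ x y = (toℕ x + toℕ y ≡ᵇ 1) ∨ (toℕ x + toℕ y ≡ᵇ 3)
  where open Data.Nat using (_+_)

-- C_{(n-1),1}: cycle 0 − 1 − … − (n-2) − 0 of order c = n-1,
-- plus the pendant vertex n-1 adjacent to 0.
Cpend : (n : ℕ) → Fin n → Fin n → Bool
Cpend n x y = not (i ≡ᵇ j) ∧ (e i j ∨ e j i)
  where
  c = n ∸ 1
  i = toℕ x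
  j = toℕ y
  e : ℕ → ℕ → Bool
  e a b = ((suc a ≡ᵇ b) ∧ (b <ᵇ c))
        ∨ ((a ≡ᵇ 0) ∧ (b ≡ᵇ c ∸ 1))
        ∨ ((a ≡ᵇ 0) ∧ (b ≡ᵇ c))

{-# OPTIONS --safe #-}
module Submission where

open import Defs
open import Data.Nat using (ℕ; _≤_; _∸_)
open import Data.Product using (_×_)
open import Data.Sum using (_⊎_)
open import Function.Bundles using (_⇔_)

-- Let S be E-independent with |S| = n - 1 ≥ 3, witnessed by p ∈ S and w. Then w ∉ S, so S is
-- everything but w, and w ∈ ⟨S - p⟩ while w ∉ ⟨S - a⟩ for the other a ∈ S. A cycle missing w or
-- a vertex a ≢ p would put w into such a ⟨S - a⟩, so every cycle contains every vertex except
-- possibly p, and since S - p is not cycle convex some cycle avoids p. That cycle is a Hamiltonian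
-- cycle of G - p; a chord of it, or a second neighbour of p on it, would close a cycle missing a
-- vertex other than p. Hence G is C_{(n-1),1}, with p pendant.
--
-- Conversely, every cycle of C_{(n-1),1} is its (n-1)-cycle, since deleting a cycle vertex leaves
-- a tree. With hub 0 and pendant p, the set S of all vertices but 0 is E-independent with
-- witness (p, 0): the (n-1)-cycle puts 0 into ⟨S - p⟩, while S - a is cycle convex for every
-- other a ∈ S.
-- For n = 3 every connected graph is K₃ or P₃, and two vertices always form an E-independent set.

open import Data.Bool using (Bool; true; false)
import Data.Bool.Properties as Boolₚ
open import Data.Empty using (⊥; ⊥-elim)
open import Data.Fin as Fin using (Fin; toℕ; zero; suc)
import Data.Fin.Properties as Finₚ
import Data.Fin.Permutation as Perm
open import Data.Fin.Subset
  using (Subset; _∈_; _∉_; ⁅_⁆; _∪_; _─_; _-_; ∣_∣; ⊤; ∁; _⊂_) renaming (_⊆_ to _⊆ₛ_)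
open import Data.Fin.Subset.Properties
  using (_∈?_; x∈⁅x⁆; x≢y⇒x∉⁅y⁆; x∈⁅y⁆⇒x≡y; x∈p∪q⁺; x∈p∪q⁻; x∈p∧x≢y⇒x∈p-y; p─q⊆p;
         p⊆q⇒∣p∣≤∣q∣; p⊂q⇒∣p∣<∣q∣; ∣⊤∣≡n; ∣⁅x⁆∣≡1; ∣∁p∣≡n∸∣p∣; ∈⊤; x∈∁p⇒x∉p; x∉p⇒x∈∁p)
open import Data.List using (List; []; _∷_; _++_; [_]; length; map)
import Data.List.Properties as Listₚ
open import Data.List.Extrema.Nat using (argmax; argmax-sel; f[⊥]≤f[argmax]; f[xs]≤f[argmax])
open import Data.List.Membership.Propositional using () renaming (_∈_ to _∈ₗ_; _∉_ to _∉ₗ_)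
open import Data.List.Membership.Propositional.Properties
  using (∈-∃++; ∈-lookup; ∈-map⁻; ∈-++⁻; ∈-++⁺ˡ; ∈-++⁺ʳ)
open import Data.List.Relation.Unary.Any as Any using (here; there)
import Data.List.Relation.Unary.Any.Properties as Anyₚ
open import Data.List.Relation.Unary.All as All using (All; []; _∷_)
import Data.List.Relation.Unary.All.Properties as Allₚ
open import Data.List.Relation.Unary.AllPairs using ([]; _∷_)
open import Data.List.Relation.Unary.Unique.Propositional using (Unique)
import Data.List.Relation.Unary.Unique.Propositional.Properties as Uniqueₚ
open import Data.List.Relation.Binary.Permutation.Propositional using (_↭_; ↭-refl; ↭-sym; ↭⇒↭ₛ)
open import Data.List.Relation.Binary.Permutation.Propositional.Properties
  using (++-comm; ↭-length; ∈-resp-↭; All-resp-↭)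
import Data.List.Relation.Binary.Permutation.Setoid.Properties as Permₛ
open import Data.Nat using (zero; suc; _+_; _<_; z≤n; s≤s)
import Data.Nat.Properties as ℕₚ
open import Data.Nat.DivMod using (_mod_; m<n⇒m%n≡m)
open import Data.Product using (∃-syntax; _,_; proj₁; proj₂)
open import Data.Sum as Sum using (inj₁; inj₂)
open import Data.Vec using ([]; _∷_; here; there)
open import Function using (id; _∘_)
open import Function.Bundles using (_↔_; Inverse; Injection; mk↔ₛ′; mk⇔)
open import Function.Properties.Inverse using (↔⇒↣)
open import Relation.Binary.Definitions using (tri<; tri≈; tri>)
open import Relation.Binary.PropositionalEquality as ≡ using (_≡_; _≢_; refl; trans; cong; subst)
open import Relation.Nullary using (¬_; Dec; does; yes; no; ¬?)
open import Relation.Nullary.Decidable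
  using (True; toWitness; _×-dec_; _⊎-dec_; decidable-stable; dec-true; dec-false)

lastOr : {A : Set} → A → List A → A
lastOr x []       = x
lastOr x (y ∷ ys) = lastOr y ys

lastOr-∷ʳ : {A : Set} (x : A) (xs : List A) (y : A) → lastOr x (xs ++ [ y ]) ≡ y
lastOr-∷ʳ x []       y = refl
lastOr-∷ʳ x (z ∷ xs) y = lastOr-∷ʳ z xs y

lastOr-∈ : {A : Set} (x y : A) (ys : List A) → lastOr x (y ∷ ys) ∈ₗ y ∷ ys
lastOr-∈ x y []       = here refl
lastOr-∈ x y (z ∷ ys) = there (lastOr-∈ y z ys)

lookup-injective : ∀ {A : Set} {xs : List A} → Unique xs →
                   ∀ {i j} → Data.List.lookup xs i ≡ Data.List.lookup xs j → i ≡ j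
lookup-injective (_  ∷ _) {zero}  {zero}  _ = refl
lookup-injective (x∉ ∷ _) {zero}  {suc j} e = ⊥-elim (All.lookup x∉ (∈-lookup j) e)
lookup-injective (x∉ ∷ _) {suc i} {zero}  e = ⊥-elim (All.lookup x∉ (∈-lookup i) (≡.sym e))
lookup-injective (_  ∷ u) {suc i} {suc j} e = cong suc (lookup-injective u e)

Unique⇒length≤ : ∀ {n} {xs : List (Fin n)} → Unique xs → length xs ≤ n
Unique⇒length≤ u = Finₚ.injective⇒≤ (lookup-injective u)

nth : {A : Set} → A → List A → ℕ → A
nth d []       _       = d
nth d (x ∷ _)  zero    = x
nth d (_ ∷ xs) (suc i) = nth d xs i

nth-lookup : ∀ {A : Set} (d : A) xs (i : Fin (length xs)) → nth d xs (toℕ i) ≡ Data.List.lookup xs i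
nth-lookup d (_ ∷ _)  zero    = refl
nth-lookup d (_ ∷ xs) (suc i) = nth-lookup d xs i

nth-++ˡ : ∀ {A : Set} (d : A) xs ys {i} → i < length xs → nth d (xs ++ ys) i ≡ nth d xs i
nth-++ˡ d (_ ∷ _)  ys {zero}  _           = refl
nth-++ˡ d (_ ∷ xs) ys {suc i} (s≤s i<len) = nth-++ˡ d xs ys i<len

nth-++-length : ∀ {A : Set} (d : A) xs y ys → nth d (xs ++ y ∷ ys) (length xs) ≡ y
nth-++-length d []       y ys = refl
nth-++-length d (_ ∷ xs) y ys = nth-++-length d xs y ys

∃-bounded-list? : ∀ {n} (k : ℕ) {P : List (Fin n) → Set} → (∀ xs → Dec (P xs)) →
                  Dec (∃[ xs ] (length xs ≤ k × P xs))
∃-bounded-list? k P? with P? []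
... | yes p = yes ([] , z≤n , p)
∃-bounded-list? zero    P? | no ¬p = no λ { ([] , _ , p) → ¬p p }
∃-bounded-list? (suc k) P? | no ¬p with Finₚ.any? (λ x → ∃-bounded-list? k (P? ∘ (x ∷_)))
... | yes (x , xs , l≤k , p) = yes (x ∷ xs , s≤s l≤k , p)
... | no ¬q = no λ { ([] , _ , p) → ¬p p ; (x ∷ xs , s≤s l≤k , p) → ¬q (x , xs , l≤k , p) }

≡-does : ∀ {b : Bool} {P : Set} → (b ≡ true → P) → (P → b ≡ true) → (P? : Dec P) → b ≡ does P?
≡-does {true}  to _    P? = ≡.sym (dec-true P? (to refl))
≡-does {false} _  from P? = ≡.sym (dec-false P? λ p → false≢true (from p))
  where
  false≢true : false ≢ true
  false≢true ()

∣p∪q∣≤∣p∣+∣q∣ : ∀ {n} (p q : Subset n) → ∣ p ∪ q ∣ ≤ ∣ p ∣ + ∣ q ∣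
∣p∪q∣≤∣p∣+∣q∣ []           []           = z≤n
∣p∪q∣≤∣p∣+∣q∣ (true  ∷ p) (true  ∷ q) =
  s≤s (ℕₚ.≤-trans (∣p∪q∣≤∣p∣+∣q∣ p q) (ℕₚ.+-monoʳ-≤ ∣ p ∣ (ℕₚ.n≤1+n ∣ q ∣)))
∣p∪q∣≤∣p∣+∣q∣ (true  ∷ p) (false ∷ q) = s≤s (∣p∪q∣≤∣p∣+∣q∣ p q)
∣p∪q∣≤∣p∣+∣q∣ (false ∷ p) (true  ∷ q) =
  subst (∣ p ∪ q ∣ <_) (≡.sym (ℕₚ.+-suc ∣ p ∣ ∣ q ∣)) (s≤s (∣p∪q∣≤∣p∣+∣q∣ p q))
∣p∪q∣≤∣p∣+∣q∣ (false ∷ p) (false ∷ q) = ∣p∪q∣≤∣p∣+∣q∣ p q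

x∈p─q⇒x∉q : ∀ {n} (p q : Subset n) {x} → x ∈ p ─ q → x ∉ q
x∈p─q⇒x∉q (_ ∷ p) (false ∷ q) (there x∈p─q) (there x∈q) = x∈p─q⇒x∉q p q x∈p─q x∈q
x∈p─q⇒x∉q (_ ∷ p) (true  ∷ q) (there x∈p─q) (there x∈q) = x∈p─q⇒x∉q p q x∈p─q x∈q

x∈p-y⇒x≢y : ∀ {n} {p : Subset n} {x y} → x ∈ p - y → x ≢ y
x∈p-y⇒x≢y {p = p} {y = y} x∈p-y refl = x∈p─q⇒x∉q p ⁅ y ⁆ x∈p-y (x∈⁅x⁆ y)

x∈p∪⁅y⁆∧x∉p⇒x≡y : ∀ {n} {p : Subset n} {x y} → x ∈ p ∪ ⁅ y ⁆ → x ∉ p → x ≡ y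
x∈p∪⁅y⁆∧x∉p⇒x≡y {p = p} {y = y} x∈ x∉p with x∈p∪q⁻ p ⁅ y ⁆ x∈
... | inj₁ x∈p = ⊥-elim (x∉p x∈p)
... | inj₂ x∈y = x∈⁅y⁆⇒x≡y y x∈y

adj⇒≢ : ∀ {n} (G : Graph n) {x y} → adj G x y ≡ true → x ≢ y
adj⇒≢ G {x} x~y refl with trans (≡.sym x~y) (irrefl G x)
... | ()

Connected⇒neighbour : ∀ {n} (G : Graph n) → Connected G → ∀ {x y} → x ≢ y → ∃[ z ] adj G x z ≡ true
Connected⇒neighbour G conn {x} {y} x≢y with conn x y
... | here       = ⊥-elim (x≢y refl)
... | step e _   = _ , e

-- Cycles, cycle hulls and E-independence

module Cycles {n : ℕ} (G : Graph n) where

  Chain-++⁻ : ∀ {x} xs {ys} → Chain G x (xs ++ ys) → Chain G x xs × Chain G (lastOr x xs) ys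
  Chain-++⁻ []       c       = [] , c
  Chain-++⁻ (_ ∷ xs) (e ∷ c) = let c₁ , c₂ = Chain-++⁻ xs c in e ∷ c₁ , c₂

  Chain-++⁺ : ∀ {x} xs {ys} → Chain G x xs → Chain G (lastOr x xs) ys → Chain G x (xs ++ ys)
  Chain-++⁺ []       []       c₂ = c₂
  Chain-++⁺ (_ ∷ xs) (e ∷ c₁) c₂ = e ∷ Chain-++⁺ xs c₁ c₂

  IsCycle : Fin n → List (Fin n) → Set
  IsCycle v xs = 2 ≤ length xs × Unique (v ∷ xs) × Chain G v (xs ++ [ v ])

  IsCycle-rotate : ∀ {v xs a} → IsCycle v xs → a ∈ₗ v ∷ xs →
                   ∃[ ys ] (IsCycle a ys × v ∷ xs ↭ a ∷ ys)
  IsCycle-rotate cyc (here refl) = _ , cyc , ↭-refl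
  IsCycle-rotate {v} {a = a} (len , u , ch) (there a∈xs) with ∈-∃++ a∈xs
  ... | B , C , refl = C ++ v ∷ B , (len′ , Permₛ.Unique-resp-↭ (≡.setoid _) (↭⇒↭ₛ σ) u , ch′) , σ
    where
    σ : v ∷ B ++ a ∷ C ↭ a ∷ C ++ v ∷ B
    σ = ++-comm (v ∷ B) (a ∷ C)
    len′ : 2 ≤ length (C ++ v ∷ B)
    len′ = subst (2 ≤_) (ℕₚ.suc-injective (↭-length σ)) len
    halves : Chain G v (B ++ [ a ]) × Chain G (lastOr v (B ++ [ a ])) (C ++ [ v ])
    halves = Chain-++⁻ (B ++ [ a ])
               (subst (Chain G v) (trans (Listₚ.++-assoc B (a ∷ C) [ v ])
                                         (≡.sym (Listₚ.++-assoc B [ a ] (C ++ [ v ])))) ch)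
    ch′ : Chain G a ((C ++ v ∷ B) ++ [ a ])
    ch′ = subst (Chain G a) (trans (Listₚ.++-assoc C [ v ] (B ++ [ a ]))
                                   (≡.sym (Listₚ.++-assoc C (v ∷ B) [ a ])))
            (Chain-++⁺ (C ++ [ v ])
              (subst (λ z → Chain G z (C ++ [ v ])) (lastOr-∷ʳ v B a) (proj₂ halves))
              (subst (λ z → Chain G z (B ++ [ a ])) (≡.sym (lastOr-∷ʳ a C v)) (proj₁ halves)))

  IsCycle-≢ : ∀ {v xs} → IsCycle v xs → ∃[ x ] (x ∈ₗ xs × x ≢ v)
  IsCycle-≢ {xs = x ∷ _} (_ , ((v≢x ∷ _) ∷ _) , _) = x , here refl , v≢x ∘ ≡.sym

  Chain-nth : ∀ d {x zs} → Chain G x zs → ∀ {i} → suc i < length (x ∷ zs) →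
              adj G (nth d (x ∷ zs) i) (nth d (x ∷ zs) (suc i)) ≡ true
  Chain-nth d []      {zero}  (s≤s ())
  Chain-nth d (e ∷ _) {zero}  _          = e
  Chain-nth d (_ ∷ c) {suc i} (s≤s 1+i<) = Chain-nth d c 1+i<

  CycleThroughIn⇒IsCycle : ∀ {U v} → CycleThroughIn G U v →
                           ∃[ xs ] (IsCycle v xs × All (_∈ U) (v ∷ xs))
  CycleThroughIn⇒IsCycle (xs , len , v∈U , xs⊆U , u , ch) = xs , (len , u , ch) , v∈U ∷ xs⊆U

  IsCycle⇒CycleThroughIn : ∀ {U v xs} → IsCycle v xs → All (_∈ U) (v ∷ xs) → CycleThroughIn G U v
  IsCycle⇒CycleThroughIn {xs = xs} (len , u , ch) (v∈U ∷ xs⊆U) = xs , len , v∈U , xs⊆U , u , ch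

module Hull {n : ℕ} (G : Graph n) where
  open Cycles G
  open import Data.List.Relation.Unary.Unique.DecPropositional (Finₚ._≟_ {n}) using (unique?)

  Chain? : ∀ x ys → Dec (Chain G x ys)
  Chain? x []       = yes []
  Chain? x (y ∷ ys) with adj G x y Boolₚ.≟ true | Chain? y ys
  ... | yes e | yes c = yes (e ∷ c)
  ... | no ¬e | _     = no λ { (e ∷ _) → ¬e e }
  ... | yes _ | no ¬c = no λ { (_ ∷ c) → ¬c c }

  CycleThroughIn? : ∀ U v → Dec (CycleThroughIn G U v)
  CycleThroughIn? U v with ∃-bounded-list? n (λ xs →
    2 ℕₚ.≤? length xs ×-dec v ∈? U ×-dec All.all? (_∈? U) xs ×-dec
    unique? (v ∷ xs) ×-dec Chain? v (xs ++ [ v ]))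
  ... | yes (xs , _ , c) = yes (xs , c)
  ... | no ¬c = no λ { (xs , c@(_ , _ , _ , u , _)) → ¬c (xs , short u , c) }
    where
    short : ∀ {xs} → Unique (v ∷ xs) → length xs ≤ n
    short u = ℕₚ.≤-trans (ℕₚ.n≤1+n _) (Unique⇒length≤ u)

  InCycleInterval? : ∀ S v → Dec (InCycleInterval G S v)
  InCycleInterval? S v = ¬? (v ∈? S) ×-dec CycleThroughIn? (S ∪ ⁅ v ⁆) v

  ¬CycleConvex⇒InCycleInterval : ∀ {S} → ¬ CycleConvex G S → ∃[ v ] InCycleInterval G S v
  ¬CycleConvex⇒InCycleInterval {S} ¬conv with Finₚ.any? (InCycleInterval? S)
  ... | yes v = v
  ... | no ¬v = ⊥-elim (¬conv λ v _ v∈I → ¬v (v , v∈I))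

  ∈⇒InHull : ∀ {S x} → x ∈ S → InHull G S x
  ∈⇒InHull x∈S _ S⊆T _ = S⊆T x∈S

  InHull-trans : ∀ {S S′ x} → (∀ {z} → z ∈ S′ → InHull G S z) → InHull G S′ x → InHull G S x
  InHull-trans S′⊆⟨S⟩ x∈⟨S′⟩ T S⊆T convT = x∈⟨S′⟩ T (λ z∈S′ → S′⊆⟨S⟩ z∈S′ T S⊆T convT) convT

  InHull⇒¬CycleConvex : ∀ {S x} → InHull G S x → x ∉ S → ¬ CycleConvex G S
  InHull⇒¬CycleConvex x∈⟨S⟩ x∉S conv = x∉S (x∈⟨S⟩ _ id conv)

  IsCycle⇒InHull : ∀ {S v xs} → IsCycle v xs → All (InHull G S) xs → InHull G S v
  IsCycle⇒InHull {v = v} cyc xs⊆⟨S⟩ T S⊆T convT with v ∈? T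
  ... | yes v∈T = v∈T
  ... | no  v∉T = ⊥-elim (convT v v∉T (v∉T , IsCycle⇒CycleThroughIn cyc
                    (x∈p∪q⁺ (inj₂ (x∈⁅x⁆ v)) ∷ All.map (λ z∈⟨S⟩ → x∈p∪q⁺ (inj₁ (z∈⟨S⟩ T S⊆T convT)))
                                                        xs⊆⟨S⟩)))

  on-cycle⇒InHull : ∀ {T v xs u} → IsCycle v xs → u ∈ₗ v ∷ xs →
                    (∀ {z} → z ∈ₗ v ∷ xs → z ≢ u → InHull G T z) → InHull G T u
  on-cycle⇒InHull cyc u∈cyc rest with IsCycle-rotate cyc u∈cyc
  ... | _ , cyc′@(_ , (u∉ys ∷ _) , _) , σ = IsCycle⇒InHull cyc′ (All.tabulate λ z∈ys →
    rest (∈-resp-↭ (↭-sym σ) (there z∈ys)) (λ z≡u → All.lookup u∉ys z∈ys (≡.sym z≡u)))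

module EIndependence {n : ℕ} (G : Graph n) where
  open Hull G

  ExchangeWitness : Subset n → Fin n → Fin n → Set
  ExchangeWitness S p p′ =
    p ∈ S × InHull G (S - p) p′ × (∀ a → a ∈ S → ¬ a ≡ p → ¬ InHull G (S - a) p′)

  -- If p′ ∈ S then p′ ∈ S - a for every a ∈ S other than p and p′, so S ⊆ {p, p′}.
  ExchangeWitness-∉ : ∀ {S p p′} → 3 ≤ ∣ S ∣ → ExchangeWitness S p p′ → p′ ∉ S
  ExchangeWitness-∉ {S} {p} {p′} 3≤∣S∣ (_ , _ , separated) p′∈S = ℕₚ.<⇒≱ 3≤∣S∣ ∣S∣≤2
    where
    S⊆pp′ : S ⊆ₛ ⁅ p ⁆ ∪ ⁅ p′ ⁆
    S⊆pp′ {z} z∈S with z Finₚ.≟ p | z Finₚ.≟ p′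
    ... | yes refl | _        = x∈p∪q⁺ (inj₁ (x∈⁅x⁆ z))
    ... | no _     | yes refl = x∈p∪q⁺ (inj₂ (x∈⁅x⁆ z))
    ... | no z≢p   | no z≢p′  =
      ⊥-elim (separated z z∈S z≢p (∈⇒InHull (x∈p∧x≢y⇒x∈p-y p′∈S (z≢p′ ∘ ≡.sym))))
    ∣S∣≤2 : ∣ S ∣ ≤ 2
    ∣S∣≤2 = ℕₚ.≤-trans (p⊆q⇒∣p∣≤∣q∣ S⊆pp′) (ℕₚ.≤-trans (∣p∪q∣≤∣p∣+∣q∣ ⁅ p ⁆ ⁅ p′ ⁆)
              (ℕₚ.≤-reflexive (≡.cong₂ _+_ (∣⁅x⁆∣≡1 p) (∣⁅x⁆∣≡1 p′))))

  EIndependent⇒∣∣≤n∸1 : 3 ≤ n → ∀ S → EIndependent G S → ∣ S ∣ ≤ n ∸ 1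
  EIndependent⇒∣∣≤n∸1 3≤n S ind with Finₚ.any? (λ x → ¬? (x ∈? S))
  ... | yes (x , x∉S) =
    ℕₚ.<⇒≤pred (subst (∣ S ∣ <_) (∣⊤∣≡n n) (p⊂q⇒∣p∣<∣q∣ ((λ _ → ∈⊤) , x , ∈⊤ , x∉S)))
  ... | no ¬x∉S with ind
  ...   | _ , inj₁ ∣S∣≡1 =
    subst (_≤ n ∸ 1) (≡.sym ∣S∣≡1) (ℕₚ.≤-trans (s≤s z≤n) (ℕₚ.∸-monoˡ-≤ 1 3≤n))
  ...   | _ , inj₂ (_ , p′ , witness) = ⊥-elim (ExchangeWitness-∉ 3≤∣S∣ witness (∈S p′))
    where
    ∈S : ∀ x → x ∈ S
    ∈S x = decidable-stable (x ∈? S) (λ x∉S → ¬x∉S (x , x∉S))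
    3≤∣S∣ : 3 ≤ ∣ S ∣
    3≤∣S∣ = ℕₚ.≤-trans 3≤n (subst (_≤ ∣ S ∣) (∣⊤∣≡n n) (p⊆q⇒∣p∣≤∣q∣ {p = ⊤} (λ {x} _ → ∈S x)))

module Ranking {n : ℕ} (G : Graph n) where
  open Cycles G

  -- At a vertex of maximal rank on a cycle both cyclic neighbours would have to be its parent.
  ranked⇒¬IsCycle : (P : Fin n → Set) (rank : Fin n → ℕ) (parent : Fin n → Fin n) →
    (∀ {x y} → P x → P y → adj G x y ≡ true → rank y ≤ rank x → y ≡ parent x) →
    ∀ {v xs} → IsCycle v xs → All P (v ∷ xs) → ⊥
  ranked⇒¬IsCycle P rank parent downhill {v} {xs} cyc Pvxs =
    let _ , cyc′ , σ = IsCycle-rotate cyc top∈ in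
    peak cyc′ (All-resp-↭ σ Pvxs) (All.tail (All-resp-↭ σ below-top))
    where
    top : Fin n
    top = argmax rank v xs
    top∈ : top ∈ₗ v ∷ xs
    top∈ with argmax-sel rank v xs
    ... | inj₁ top≡v   = here top≡v
    ... | inj₂ top∈xs = there top∈xs
    below-top : All (λ z → rank z ≤ rank top) (v ∷ xs)
    below-top = f[⊥]≤f[argmax] {f = rank} v xs ∷ f[xs]≤f[argmax] {f = rank} v xs
    peak : ∀ {ys} → IsCycle top ys → All P (top ∷ ys) → All (λ z → rank z ≤ rank top) ys → ⊥
    peak {[]}         (() , _)
    peak {_ ∷ []}     (s≤s () , _)
    peak {y ∷ z ∷ zs} (_ , (_ ∷ y∉zs ∷ _) , top~y ∷ ch) (Ptop ∷ Py ∷ Pzs) (y≤top ∷ zs≤top) =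
      All.lookup y∉zs ℓ∈ (trans (downhill Ptop Py top~y y≤top)
                                (≡.sym (downhill Ptop (All.lookup Pzs ℓ∈) top~ℓ (All.lookup zs≤top ℓ∈))))
      where
      ℓ : Fin n
      ℓ = lastOr y (z ∷ zs)
      ℓ∈ : ℓ ∈ₗ z ∷ zs
      ℓ∈ = lastOr-∈ y z zs
      top~ℓ : adj G top ℓ ≡ true
      top~ℓ with Chain-++⁻ (z ∷ zs) ch
      ... | _ , ℓ~top ∷ [] = trans (Graph.sym G top ℓ) ℓ~top

-- Three vertices

¬CycleThroughIn-pair : ∀ {n} (G : Graph n) {U v u} → (∀ {z} → z ∈ U → z ≡ v ⊎ z ≡ u) →
                       ¬ CycleThroughIn G U v
¬CycleThroughIn-pair G U⊆vu (_ ∷ [] , s≤s () , _)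
¬CycleThroughIn-pair G U⊆vu (x ∷ y ∷ _ , _ , _ , x∈U ∷ y∈U ∷ _ , ((v≢x ∷ v≢y ∷ _) ∷ (x≢y ∷ _) ∷ _) , _)
  with U⊆vu x∈U | U⊆vu y∈U
... | inj₁ x≡v | _        = v≢x (≡.sym x≡v)
... | inj₂ _   | inj₁ y≡v = v≢y (≡.sym y≡v)
... | inj₂ x≡u | inj₂ y≡u = x≢y (trans x≡u (≡.sym y≡u))

CycleConvex-⁅⁆ : ∀ {n} (G : Graph n) x → CycleConvex G ⁅ x ⁆
CycleConvex-⁅⁆ G x v _ (_ , cyc) = ¬CycleThroughIn-pair G xv cyc
  where
  xv : ∀ {z} → z ∈ ⁅ x ⁆ ∪ ⁅ v ⁆ → z ≡ v ⊎ z ≡ x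
  xv {z} z∈ with x∈p∪q⁻ ⁅ x ⁆ ⁅ v ⁆ z∈
  ... | inj₁ z∈x = inj₂ (x∈⁅y⁆⇒x≡y x z∈x)
  ... | inj₂ z∈v = inj₁ (x∈⁅y⁆⇒x≡y v z∈v)

ExchangeNumber-3 : (G : Graph 3) → ExchangeNumber G 2
ExchangeNumber-3 G =
  (S , ((1F , 1∈S) , inj₂ (1F , 2F , 1∈S , ∈⇒InHull (there (there here)) , separated)) , refl) ,
  EIndependent⇒∣∣≤n∸1 (s≤s (s≤s (s≤s z≤n)))
  where
  open Hull G
  open EIndependence G
  1F 2F : Fin 3
  1F = suc zero
  2F = suc (suc zero)
  S : Subset 3
  S = ∁ ⁅ zero ⁆
  1∈S : 1F ∈ S
  1∈S = there here
  separated : ∀ a → a ∈ S → a ≢ 1F → ¬ InHull G (S - a) 2F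
  separated (suc zero)       _ a≢1 _ = a≢1 refl
  separated (suc (suc zero)) _ _   2∈⟨1⟩ with x∈⁅y⁆⇒x≡y 1F (2∈⟨1⟩ ⁅ 1F ⁆ id (CycleConvex-⁅⁆ G 1F))
  ... | ()

table : Bool → Bool → Bool → Fin 3 → Fin 3 → Bool
table a b c zero             (suc zero)       = a
table a b c (suc zero)       zero             = a
table a b c zero             (suc (suc zero)) = b
table a b c (suc (suc zero)) zero             = b
table a b c (suc zero)       (suc (suc zero)) = c
table a b c (suc (suc zero)) (suc zero)       = c
table a b c _                _                = false

adj≡table : (G : Graph 3) →
            ∀ x y → adj G x y ≡ table (adj G zero (suc zero)) (adj G zero (suc (suc zero)))
                                      (adj G (suc zero) (suc (suc zero))) x y
adj≡table G zero             zero             = irrefl G zero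
adj≡table G zero             (suc zero)       = refl
adj≡table G zero             (suc (suc zero)) = refl
adj≡table G (suc zero)       zero             = Graph.sym G _ _
adj≡table G (suc zero)       (suc zero)       = irrefl G _
adj≡table G (suc zero)       (suc (suc zero)) = refl
adj≡table G (suc (suc zero)) zero             = Graph.sym G _ _
adj≡table G (suc (suc zero)) (suc zero)       = Graph.sym G _ _
adj≡table G (suc (suc zero)) (suc (suc zero)) = irrefl G _

isolated⇒¬Walk : ∀ {n} (G : Graph n) {v u} → (∀ x → adj G v x ≡ false) → v ≢ u → ¬ Walk G v u
isolated⇒¬Walk G isolated v≢u here       = v≢u refl
isolated⇒¬Walk G isolated v≢u (step e _) with trans (≡.sym e) (isolated _)
... | ()

module _ (G : Graph 3) {a b c : Bool} (adj≡ : ∀ x y → adj G x y ≡ table a b c x y) where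

  ≅-by-evaluation : (A : Fin 3 → Fin 3 → Bool) (σ : Fin 3 ↔ Fin 3) →
    {True (Finₚ.all? λ x → Finₚ.all? λ y →
             table a b c x y Boolₚ.≟ A (Inverse.to σ x) (Inverse.to σ y))} →
    G ≅ A
  ≅-by-evaluation A σ {t} = σ , λ x y → trans (adj≡ x y) (toWitness t x y)

  isolated-by-evaluation : ∀ v → {True (Finₚ.all? λ x → table a b c v x Boolₚ.≟ false)} →
                           ∀ x → adj G v x ≡ false
  isolated-by-evaluation v {t} x = trans (adj≡ v x) (toWitness t x)

Connected-3 : (G : Graph 3) → Connected G → G ≅ K₃ ⊎ G ≅ P₃
Connected-3 G conn = classify _ _ _ (adj≡table G)
  where
  0F 1F 2F : Fin 3
  0F = zero
  1F = suc zero
  2F = suc (suc zero)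
  classify : ∀ a b c → (∀ x y → adj G x y ≡ table a b c x y) → G ≅ K₃ ⊎ G ≅ P₃
  classify true  true  true  adj≡ = inj₁ (≅-by-evaluation G adj≡ K₃ Perm.id)
  classify true  true  false adj≡ = inj₂ (≅-by-evaluation G adj≡ P₃ (Perm.transpose 0F 1F))
  classify true  false true  adj≡ = inj₂ (≅-by-evaluation G adj≡ P₃ Perm.id)
  classify false true  true  adj≡ = inj₂ (≅-by-evaluation G adj≡ P₃ (Perm.transpose 1F 2F))
  classify true  false false adj≡ =
    ⊥-elim (isolated⇒¬Walk G (isolated-by-evaluation G adj≡ 2F) (λ ()) (conn 2F 0F))
  classify false true  false adj≡ =
    ⊥-elim (isolated⇒¬Walk G (isolated-by-evaluation G adj≡ 1F) (λ ()) (conn 1F 0F))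
  classify false false _     adj≡ =
    ⊥-elim (isolated⇒¬Walk G (isolated-by-evaluation G adj≡ 0F) (λ ()) (conn 0F 1F))

-- The graph C_{(n-1),1}

Arc : ℕ → ℕ → ℕ → Set
Arc c a b = (suc a ≡ b × b < c) ⊎ (a ≡ 0 × b ≡ c ∸ 1) ⊎ (a ≡ 0 × b ≡ c)

CpendEdge : ℕ → ℕ → ℕ → Set
CpendEdge c a b = a ≢ b × (Arc c a b ⊎ Arc c b a)

Arc? : ∀ c a b → Dec (Arc c a b)
Arc? c a b =
  (suc a ℕₚ.≟ b ×-dec b ℕₚ.<? c) ⊎-dec (a ℕₚ.≟ 0 ×-dec b ℕₚ.≟ c ∸ 1) ⊎-dec (a ℕₚ.≟ 0 ×-dec b ℕₚ.≟ c)

CpendEdge? : ∀ c a b → Dec (CpendEdge c a b)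
CpendEdge? c a b = ¬? (a ℕₚ.≟ b) ×-dec (Arc? c a b ⊎-dec Arc? c b a)

-- The Boolean matrix Cpend is, by unfolding, the decision procedure CpendEdge?.
Cpend-sound : ∀ n x y → Cpend n x y ≡ true → CpendEdge (n ∸ 1) (toℕ x) (toℕ y)
Cpend-sound n x y = does-true (CpendEdge? (n ∸ 1) (toℕ x) (toℕ y))
  where
  does-true : ∀ {P : Set} (P? : Dec P) → does P? ≡ true → P
  does-true (yes p) _ = p

Cpend-complete : ∀ n x y → CpendEdge (n ∸ 1) (toℕ x) (toℕ y) → Cpend n x y ≡ true
Cpend-complete n x y = dec-true (CpendEdge? (n ∸ 1) (toℕ x) (toℕ y))

range : ℕ → ℕ → List ℕ
range a zero    = []
range a (suc k) = a ∷ range (suc a) k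

∈-range⁻ : ∀ {a k i} → i ∈ₗ range a k → a ≤ i × i < a + k
∈-range⁻ {a} {suc k} (here refl) = ℕₚ.≤-refl , ℕₚ.m<m+n a (s≤s z≤n)
∈-range⁻ {a} {suc k} {i} (there i∈) =
  let a<i , i<1+a+k = ∈-range⁻ i∈ in ℕₚ.<⇒≤ a<i , subst (i <_) (≡.sym (ℕₚ.+-suc a k)) i<1+a+k

length-range : ∀ a k → length (range a k) ≡ k
length-range a zero    = refl
length-range a (suc k) = cong suc (length-range (suc a) k)

lastOr-range : ∀ a k → lastOr a (range (suc a) k) ≡ a + k
lastOr-range a zero    = ≡.sym (ℕₚ.+-identityʳ a)
lastOr-range a (suc k) = trans (lastOr-range (suc a) k) (≡.sym (ℕₚ.+-suc a k))

Unique-range : ∀ a k → Unique (range a k)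
Unique-range a zero    = []
Unique-range a (suc k) = All.tabulate (ℕₚ.<⇒≢ ∘ proj₁ ∘ ∈-range⁻) ∷ Unique-range (suc a) k

Unique-range-++ : ∀ a k b l → a + k ≤ b → Unique (range a k ++ range b l)
Unique-range-++ a k b l a+k≤b = Uniqueₚ.++⁺ (Unique-range a k) (Unique-range b l) disjoint
  where
  disjoint : ∀ {i} → i ∈ₗ range a k × i ∈ₗ range b l → ⊥
  disjoint (i∈ , i∈′) =
    ℕₚ.<⇒≱ (ℕₚ.<-≤-trans (proj₂ (∈-range⁻ i∈)) a+k≤b) (proj₁ (∈-range⁻ i∈′))

-- vertex restricts to a bijection from {0, …, n-1} onto Fin n with inverse index; its values
-- outside that range are junk.
record Labelling (n : ℕ) : Set where
  field
    vertex       : ℕ → Fin n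
    index        : Fin n → ℕ
    index<n      : ∀ x → index x < n
    vertex-index : ∀ x → vertex (index x) ≡ x
    index-vertex : ∀ {i} → i < n → index (vertex i) ≡ i

  vertex-injective : ∀ {i j} → i < n → j < n → vertex i ≡ vertex j → i ≡ j
  vertex-injective i<n j<n e = trans (≡.sym (index-vertex i<n)) (trans (cong index e) (index-vertex j<n))

  toFin : Fin n ↔ Fin n
  toFin = mk↔ₛ′ (λ x → Fin.fromℕ< (index<n x)) (vertex ∘ toℕ) to∘from from∘to
    where
    to∘from : ∀ i → Fin.fromℕ< (index<n (vertex (toℕ i))) ≡ i
    to∘from i = Finₚ.toℕ-injective (trans (Finₚ.toℕ-fromℕ< _) (index-vertex (Finₚ.toℕ<n i)))
    from∘to : ∀ x → vertex (toℕ (Fin.fromℕ< (index<n x))) ≡ x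
    from∘to x = trans (cong vertex (Finₚ.toℕ-fromℕ< _)) (vertex-index x)

  toℕ-toFin : ∀ x → toℕ (Inverse.to toFin x) ≡ index x
  toℕ-toFin x = Finₚ.toℕ-fromℕ< _

↔⇒Labelling : ∀ {n} → Fin (suc n) ↔ Fin (suc n) → Labelling (suc n)
↔⇒Labelling {n} σ = record
  { vertex       = λ i → Inverse.from σ (i mod suc n)
  ; index        = λ x → toℕ (Inverse.to σ x)
  ; index<n      = λ x → Finₚ.toℕ<n (Inverse.to σ x)
  ; vertex-index = λ x → trans (cong (Inverse.from σ) (Finₚ.toℕ-injective (toℕ-mod (Finₚ.toℕ<n _))))
                               (Inverse.strictlyInverseʳ σ x)
  ; index-vertex = λ i<n → trans (cong toℕ (Inverse.strictlyInverseˡ σ _)) (toℕ-mod i<n)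
  }
  where
  toℕ-mod : ∀ {i} → i < suc n → toℕ (i mod suc n) ≡ i
  toℕ-mod i<n = trans (Finₚ.toℕ-fromℕ< _) (m<n⇒m%n≡m i<n)

module Labelled {n : ℕ} (G : Graph n) (L : Labelling n) where
  open Cycles G
  open Labelling L

  Adj : ℕ → ℕ → Set
  Adj i j = adj G (vertex i) (vertex j) ≡ true

  Adj-sym : ∀ {i j} → Adj i j → Adj j i
  Adj-sym {i} {j} e = trans (Graph.sym G (vertex j) (vertex i)) e

  Path : ℕ → List ℕ → Set
  Path i is = Chain G (vertex i) (map vertex is)

  Path-++ : ∀ {i} is {js} → Path i is → Path (lastOr i is) js → Path i (is ++ js)
  Path-++ []       []       p₂ = p₂
  Path-++ (_ ∷ is) (e ∷ p₁) p₂ = e ∷ Path-++ is p₁ p₂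

  Path-range : ∀ a k → (∀ j → a ≤ j → j < a + k → Adj j (suc j)) → Path a (range (suc a) k)
  Path-range a zero    _    = []
  Path-range a (suc k) next =
    next a ℕₚ.≤-refl (ℕₚ.m<m+n a (s≤s z≤n)) ∷
    Path-range (suc a) k λ j a<j j<1+a+k →
      next j (ℕₚ.<⇒≤ a<j) (subst (j <_) (≡.sym (ℕₚ.+-suc a k)) j<1+a+k)

  Path-range-∷ʳ : ∀ a k {b} → (∀ j → a ≤ j → j < a + k → Adj j (suc j)) → Adj (a + k) b →
                  Path a (range (suc a) k ++ [ b ])
  Path-range-∷ʳ a k {b} next e = Path-++ (range (suc a) k) (Path-range a k next)
    (subst (λ j → Path j [ b ]) (≡.sym (lastOr-range a k)) (e ∷ []))

  IndexCycle : ℕ → List ℕ → Set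
  IndexCycle i is = 2 ≤ length is × Unique (i ∷ is) × All (_< n) (i ∷ is) × Path i (is ++ [ i ])

  range-IndexCycle : ∀ ℓ → 2 ≤ ℓ → ℓ < n → (∀ j → j < ℓ → Adj j (suc j)) → Adj ℓ 0 →
                     IndexCycle 0 (range 1 ℓ)
  range-IndexCycle ℓ 2≤ℓ ℓ<n next close =
    subst (2 ≤_) (≡.sym (length-range 1 ℓ)) 2≤ℓ ,
    Unique-range 0 (suc ℓ) ,
    All.tabulate (λ j∈ → ℕₚ.<-≤-trans (proj₂ (∈-range⁻ j∈)) ℓ<n) ,
    Path-range-∷ʳ 0 ℓ (λ j _ j<ℓ → next j j<ℓ) close

  Unique-map-vertex : ∀ {is} → All (_< n) is → Unique is → Unique (map vertex is)
  Unique-map-vertex []           []          = []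
  Unique-map-vertex {i ∷ _} (i<n ∷ is<n) (i∉is ∷ u) = distinct is<n i∉is ∷ Unique-map-vertex is<n u
    where
    distinct : ∀ {js} → All (_< n) js → All (i ≢_) js → All (vertex i ≢_) (map vertex js)
    distinct []           []          = []
    distinct (j<n ∷ js<n) (i≢j ∷ i≢js) = i≢j ∘ vertex-injective i<n j<n ∷ distinct js<n i≢js

  IndexCycle⇒IsCycle : ∀ {i is} → IndexCycle i is → IsCycle (vertex i) (map vertex is)
  IndexCycle⇒IsCycle {i} {is} (len , u , bounded , path) =
    subst (2 ≤_) (≡.sym (Listₚ.length-map vertex is)) len ,
    Unique-map-vertex bounded u ,
    subst (Chain G (vertex i)) (Listₚ.map-++ vertex is [ i ]) path

  vertex-∈⁻ : ∀ {j is} → j < n → All (_< n) is → vertex j ∈ₗ map vertex is → j ∈ₗ is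
  vertex-∈⁻ j<n bounded vj∈ with ∈-map⁻ vertex vj∈
  ... | i , i∈is , vj≡vi =
    subst (_∈ₗ _) (≡.sym (vertex-injective j<n (All.lookup bounded i∈is) vj≡vi)) i∈is

module Enumeration {n : ℕ} (d : Fin n) (F : List (Fin n))
                   (unique : Unique F) (complete : ∀ x → x ∈ₗ F) where

  position : Fin n → Fin (length F)
  position x = Any.index (complete x)

  lookup-position : ∀ x → Data.List.lookup F (position x) ≡ x
  lookup-position x = ≡.sym (Anyₚ.lookup-index (complete x))

  length≡n : length F ≡ n
  length≡n = ℕₚ.≤-antisym (Unique⇒length≤ unique) (Finₚ.injective⇒≤ position-injective)
    where
    position-injective : ∀ {x y} → position x ≡ position y → x ≡ y
    position-injective {x} {y} e =
      trans (≡.sym (lookup-position x)) (trans (cong (Data.List.lookup F) e) (lookup-position y))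

  position-nth : ∀ {i} → i < n → toℕ (position (nth d F i)) ≡ i
  position-nth {i} i<n = begin
    toℕ (position (nth d F i))  ≡⟨ cong toℕ (lookup-injective unique lookup≡) ⟩
    toℕ i′                      ≡⟨ Finₚ.toℕ-fromℕ< _ ⟩
    i                           ∎
    where
    open ≡.≡-Reasoning
    i′ : Fin (length F)
    i′ = Fin.fromℕ< (subst (i <_) (≡.sym length≡n) i<n)
    lookup≡ : Data.List.lookup F (position (nth d F i)) ≡ Data.List.lookup F i′
    lookup≡ = begin
      Data.List.lookup F (position (nth d F i))  ≡⟨ lookup-position _ ⟩
      nth d F i                                  ≡⟨ cong (nth d F) (Finₚ.toℕ-fromℕ< _) ⟨
      nth d F (toℕ i′)                           ≡⟨ nth-lookup d F i′ ⟩
      Data.List.lookup F i′                      ∎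

  labelling : Labelling n
  labelling = record
    { vertex       = nth d F
    ; index        = toℕ ∘ position
    ; index<n      = λ x → subst (toℕ (position x) <_) length≡n (Finₚ.toℕ<n (position x))
    ; vertex-index = λ x → trans (nth-lookup d F (position x)) (lookup-position x)
    ; index-vertex = position-nth
    }

-- Deleting the cycle vertex m from C_{ℓ+1,1} leaves the path m+1, …, ℓ, 0, 1, …, m-1 with the
-- pendant vertex ℓ+1 attached to 0; rank increases along it and parent is the previous vertex.
module CpendRanking (ℓ m : ℕ) (m≤ℓ : m ≤ ℓ) where

  c : ℕ
  c = suc ℓ

  rank : ℕ → ℕ
  rank i with i ℕₚ.<? m | i ℕₚ.<? c
  ... | yes _ | _     = c + i
  ... | no  _ | yes _ = i
  ... | no  _ | no  _ = c + c

  parent : ℕ → ℕ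
  parent zero    = ℓ
  parent (suc i) with i ℕₚ.≟ ℓ
  ... | yes _ = 0
  ... | no  _ = i

  rank-< : ∀ {i} → i < m → rank i ≡ c + i
  rank-< {i} i<m with i ℕₚ.<? m
  ... | yes _  = refl
  ... | no i≮m = ⊥-elim (i≮m i<m)

  rank-≥ : ∀ {i} → m ≤ i → i < c → rank i ≡ i
  rank-≥ {i} m≤i i<c with i ℕₚ.<? m | i ℕₚ.<? c
  ... | yes i<m | _      = ⊥-elim (ℕₚ.<⇒≱ i<m m≤i)
  ... | no _    | yes _  = refl
  ... | no _    | no i≮c = ⊥-elim (i≮c i<c)

  rank-c : rank c ≡ c + c
  rank-c with c ℕₚ.<? m | c ℕₚ.<? c
  ... | yes c<m | _       = ⊥-elim (ℕₚ.<⇒≱ c<m (ℕₚ.m≤n⇒m≤1+n m≤ℓ))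
  ... | no _    | yes c<c = ⊥-elim (ℕₚ.<-irrefl refl c<c)
  ... | no _    | no _    = refl

  rank-suc : ∀ {i} → suc i ≢ m → suc i < c → rank i < rank (suc i)
  rank-suc {i} 1+i≢m 1+i<c = by-cases (i ℕₚ.<? m)
    where
    open ℕₚ.≤-Reasoning
    by-cases : Dec (i < m) → rank i < rank (suc i)
    by-cases (yes i<m) = begin-strict
      rank i        ≡⟨ rank-< i<m ⟩
      c + i         <⟨ ℕₚ.+-monoʳ-< c (ℕₚ.n<1+n i) ⟩
      c + suc i     ≡⟨ rank-< (ℕₚ.≤∧≢⇒< i<m 1+i≢m) ⟨
      rank (suc i)  ∎
    by-cases (no i≮m) = begin-strict
      rank i        ≡⟨ rank-≥ (ℕₚ.≮⇒≥ i≮m) (ℕₚ.<-trans (ℕₚ.n<1+n i) 1+i<c) ⟩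
      i             <⟨ ℕₚ.n<1+n i ⟩
      suc i         ≡⟨ rank-≥ (ℕₚ.m≤n⇒m≤1+n (ℕₚ.≮⇒≥ i≮m)) 1+i<c ⟨
      rank (suc i)  ∎

  parent-suc : ∀ {i} → suc i < c → parent (suc i) ≡ i
  parent-suc {i} 1+i<c with i ℕₚ.≟ ℓ
  ... | yes refl = ⊥-elim (ℕₚ.<-irrefl refl 1+i<c)
  ... | no _     = refl

  parent-c : parent c ≡ 0
  parent-c with ℓ ℕₚ.≟ ℓ
  ... | yes _   = refl
  ... | no ℓ≢ℓ = ⊥-elim (ℓ≢ℓ refl)

  downhill : ∀ {i j} → i ≢ m → j ≢ m → CpendEdge c i j → rank j ≤ rank i → j ≡ parent i
  downhill _ j≢m (_ , inj₁ (inj₁ (refl , j<c))) j≤i = ⊥-elim (ℕₚ.<⇒≱ (rank-suc j≢m j<c) j≤i)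
  downhill _ _ (_ , inj₁ (inj₂ (inj₁ (refl , refl)))) _ = refl
  downhill 0≢m _ (_ , inj₁ (inj₂ (inj₂ (refl , refl)))) c≤0 =
    ⊥-elim (ℕₚ.<⇒≱ (ℕₚ.+-monoʳ-< c (s≤s z≤n)) (begin
      c + c   ≡⟨ rank-c ⟨
      rank c  ≤⟨ c≤0 ⟩
      rank 0  ≡⟨ rank-< (ℕₚ.n≢0⇒n>0 (0≢m ∘ ≡.sym)) ⟩
      c + 0   ∎))
    where open ℕₚ.≤-Reasoning
  downhill _ _ (_ , inj₂ (inj₁ (refl , i<c))) _ = ≡.sym (parent-suc i<c)
  downhill _ 0≢m (_ , inj₂ (inj₂ (inj₁ (refl , refl)))) 0≤ℓ =
    ⊥-elim (ℕₚ.<⇒≱ (ℕₚ.<-≤-trans (ℕₚ.n<1+n ℓ) (ℕₚ.m≤m+n c 0)) (begin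
      c + 0   ≡⟨ rank-< (ℕₚ.n≢0⇒n>0 (0≢m ∘ ≡.sym)) ⟨
      rank 0  ≤⟨ 0≤ℓ ⟩
      rank ℓ  ≡⟨ rank-≥ m≤ℓ (ℕₚ.n<1+n ℓ) ⟩
      ℓ       ∎))
    where open ℕₚ.≤-Reasoning
  downhill _ _ (_ , inj₂ (inj₂ (inj₂ (refl , refl)))) _ = ≡.sym parent-c

-- With n = 4 + k, the cycle of C_{(n-1),1} is 0, 1, …, ℓ and the pendant vertex c is adjacent to 0.
module CpendOrder (k : ℕ) where
  n c ℓ : ℕ
  n = 4 + k
  c = 3 + k
  ℓ = 2 + k

  c<n : c < n
  c<n = ℕₚ.n<1+n c

  <c⇒<n : ∀ {i} → i < c → i < n
  <c⇒<n = ℕₚ.m<n⇒m<1+n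

module CpendExchangeNumber (k : ℕ) (G : Graph (4 + k)) (G≅ : G ≅ Cpend (4 + k)) where
  open CpendOrder k

  L : Labelling n
  L = ↔⇒Labelling (proj₁ G≅)

  open Labelling L
  open Labelled G L
  open Cycles G
  open Hull G
  open EIndependence G
  open Ranking G
  open import Data.List.Membership.DecPropositional (Finₚ._≟_ {n}) using () renaming (_∈?_ to _∈ₗ?_)

  adj⇒CpendEdge : ∀ {x y} → adj G x y ≡ true → CpendEdge c (index x) (index y)
  adj⇒CpendEdge {x} {y} e = Cpend-sound n x′ y′ (trans (≡.sym (proj₂ G≅ x y)) e)
    where
    x′ y′ : Fin n
    x′ = Inverse.to (proj₁ G≅) x
    y′ = Inverse.to (proj₁ G≅) y

  CpendEdge⇒Adj : ∀ {i j} → i < n → j < n → CpendEdge c i j → Adj i j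
  CpendEdge⇒Adj {i} {j} i<n j<n e = trans (proj₂ G≅ (vertex i) (vertex j))
    (Cpend-complete n _ _
      (≡.subst₂ (CpendEdge c) (≡.sym (index-vertex i<n)) (≡.sym (index-vertex j<n)) e))

  IsCycle-spanning : ∀ {v xs} → IsCycle v xs → ∀ {m} → m < c → vertex m ∈ₗ v ∷ xs
  IsCycle-spanning {v} {xs} cyc {m} m<c =
    decidable-stable (vertex m ∈ₗ? (v ∷ xs)) λ m∉ →
      ranked⇒¬IsCycle (vertex m ≢_) (rank ∘ index) (vertex ∘ parent ∘ index) downhill′ cyc
                      (Allₚ.¬Any⇒All¬ _ m∉)
    where
    open CpendRanking ℓ m (ℕₚ.≤-pred m<c)
    ≢m : ∀ {x} → vertex m ≢ x → index x ≢ m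
    ≢m m≢x index≡m = m≢x (trans (cong vertex (≡.sym index≡m)) (vertex-index _))
    downhill′ : ∀ {x y} → vertex m ≢ x → vertex m ≢ y → adj G x y ≡ true →
                rank (index y) ≤ rank (index x) → y ≡ vertex (parent (index x))
    downhill′ m≢x m≢y e r≤ =
      trans (≡.sym (vertex-index _)) (cong vertex (downhill (≢m m≢x) (≢m m≢y) (adj⇒CpendEdge e) r≤))

  hub pendant : Fin n
  hub     = vertex 0
  pendant = vertex c

  S : Subset n
  S = ∁ ⁅ hub ⁆

  ≢hub⇒∈S : ∀ {x} → x ≢ hub → x ∈ S
  ≢hub⇒∈S = x∉p⇒x∈∁p ∘ x≢y⇒x∉⁅y⁆

  ∈S⇒≢hub : ∀ {x} → x ∈ S → x ≢ hub
  ∈S⇒≢hub x∈S refl = x∈∁p⇒x∉p x∈S (x∈⁅x⁆ hub)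

  vertex≢ : ∀ {i j} → i < n → j < n → i ≢ j → vertex i ≢ vertex j
  vertex≢ i<n j<n i≢j = i≢j ∘ vertex-injective i<n j<n

  hub∈⟨S-pendant⟩ : InHull G (S - pendant) hub
  hub∈⟨S-pendant⟩ = IsCycle⇒InHull (IndexCycle⇒IsCycle standard-cycle)
    (Allₚ.map⁺ (All.tabulate λ i∈ → ∈⇒InHull (inner (∈-range⁻ i∈))))
    where
    next : ∀ j → j < ℓ → Adj j (suc j)
    next j j<ℓ = CpendEdge⇒Adj (<c⇒<n (ℕₚ.m<n⇒m<1+n j<ℓ)) (<c⇒<n (s≤s j<ℓ))
                          (ℕₚ.1+n≢n ∘ ≡.sym , inj₁ (inj₁ (refl , s≤s j<ℓ)))
    standard-cycle : IndexCycle 0 (range 1 ℓ)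
    standard-cycle = range-IndexCycle ℓ (s≤s (s≤s z≤n)) (<c⇒<n (ℕₚ.n<1+n ℓ)) next
      (CpendEdge⇒Adj (<c⇒<n (ℕₚ.n<1+n ℓ)) (s≤s z≤n) ((λ ()) , inj₂ (inj₂ (inj₁ (refl , refl)))))
    inner : ∀ {i} → 1 ≤ i × i < 1 + ℓ → vertex i ∈ S - pendant
    inner (1≤i , i<c) = x∈p∧x≢y⇒x∈p-y (≢hub⇒∈S (vertex≢ (<c⇒<n i<c) (s≤s z≤n) (ℕₚ.m<n⇒n≢0 1≤i)))
                                      (vertex≢ (<c⇒<n i<c) c<n (ℕₚ.<⇒≢ i<c))

  separated : ∀ a → a ∈ S → a ≢ pendant → ¬ InHull G (S - a) hub
  separated a a∈S a≢pendant hub∈⟨S-a⟩ = ∈S⇒≢hub (p─q⊆p S ⁅ a ⁆ (hub∈⟨S-a⟩ (S - a) id convex)) refl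
    where
    index<c : index a < c
    index<c = ℕₚ.≤∧≢⇒< (ℕₚ.≤-pred (index<n a))
                (λ index≡c → a≢pendant (trans (≡.sym (vertex-index a)) (cong vertex index≡c)))
    -- Every cycle passes through both hub and a, which lie outside S - a.
    convex : CycleConvex G (S - a)
    convex v _ (_ , ct) with CycleThroughIn⇒IsCycle ct
    ... | _ , cyc , inU = ∈S⇒≢hub a∈S (trans (is-v a∈cyc a∉) (≡.sym (is-v hub∈cyc hub∉)))
      where
      is-v : ∀ {z} → z ∈ₗ _ → z ∉ S - a → z ≡ v
      is-v z∈cyc = x∈p∪⁅y⁆∧x∉p⇒x≡y (All.lookup inU z∈cyc)
      a∈cyc : a ∈ₗ _
      a∈cyc = subst (_∈ₗ _) (vertex-index a) (IsCycle-spanning cyc index<c)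
      hub∈cyc : hub ∈ₗ _
      hub∈cyc = IsCycle-spanning cyc (s≤s z≤n)
      a∉ : a ∉ S - a
      a∉ a∈S-a = x∈p-y⇒x≢y a∈S-a refl
      hub∉ : hub ∉ S - a
      hub∉ hub∈S-a = ∈S⇒≢hub (p─q⊆p S ⁅ a ⁆ hub∈S-a) refl

  exchangeNumber : ExchangeNumber G (n ∸ 1)
  exchangeNumber =
    (S , ((pendant , pendant∈S) , inj₂ (pendant , hub , pendant∈S , hub∈⟨S-pendant⟩ , separated)) ,
     ∣S∣) ,
    EIndependent⇒∣∣≤n∸1 (s≤s (s≤s (s≤s z≤n)))
    where
    pendant∈S : pendant ∈ S
    pendant∈S = ≢hub⇒∈S (vertex≢ c<n (s≤s z≤n) (λ ()))
    ∣S∣ : ∣ S ∣ ≡ n ∸ 1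
    ∣S∣ = trans (∣∁p∣≡n∸∣p∣ ⁅ hub ⁆) (cong (n ∸_) (∣⁅x⁆∣≡1 hub))

module CpendRecognition (k : ℕ) (G : Graph (4 + k)) (L : Labelling (4 + k))
  (next     : ∀ i → suc i < 3 + k → Labelled.Adj G L i (suc i))
  (close    : Labelled.Adj G L (2 + k) 0)
  (pendant  : Labelled.Adj G L (3 + k) 0)
  (spanning : ∀ {v xs} → Cycles.IsCycle G v xs → ∀ {j} → j < 3 + k → Labelling.vertex L j ∈ₗ v ∷ xs)
  where

  open CpendOrder k
  open Labelling L
  open Labelled G L
  open Cycles G

  IndexCycle-spanning : ∀ {i is} → IndexCycle i is → ∀ {j} → j < c → j ∈ₗ i ∷ is
  IndexCycle-spanning cyc@(_ , _ , bounded , _) j<c =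
    vertex-∈⁻ (<c⇒<n j<c) bounded (spanning (IndexCycle⇒IsCycle cyc) j<c)

  -- The chord a b turns 0, …, a, b, …, ℓ into a cycle.
  shortcut : ∀ {a b t} → a < b → b + t ≡ ℓ → Adj a b → ¬ (a ≡ 0 × t ≡ 0) →
             IndexCycle 0 (range 1 a ++ range b (suc t))
  shortcut {a} {b} {t} a<b b+t≡ℓ a~b nontrivial =
    subst (2 ≤_) (≡.sym length-is) (2≤a+1+t a t nontrivial) ,
    Unique-range-++ 0 (suc a) b (suc t) a<b ,
    All.tabulate (<c⇒<n ∘ bound) ,
    subst (Path 0) (≡.sym (Listₚ.++-assoc (range 1 a) (range b (suc t)) [ 0 ]))
      (Path-++ (range 1 a) (Path-range 0 a λ j _ j<a → next j (ℕₚ.≤-<-trans j<a a<c))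
        (subst (λ i → Path i (range b (suc t) ++ [ 0 ])) (≡.sym (lastOr-range 0 a))
          (a~b ∷ Path-range-∷ʳ b t (λ j _ j<b+t → next j (subst (suc j <_) (cong suc b+t≡ℓ) (s≤s j<b+t)))
                   (subst (λ i → Adj i 0) (≡.sym b+t≡ℓ) close))))
    where
    b+1+t≡c : b + suc t ≡ c
    b+1+t≡c = trans (ℕₚ.+-suc b t) (cong suc b+t≡ℓ)
    a<c : a < c
    a<c = ℕₚ.<-≤-trans a<b (subst (b ≤_) b+1+t≡c (ℕₚ.m≤m+n b (suc t)))
    2≤a+1+t : ∀ a′ t′ → ¬ (a′ ≡ 0 × t′ ≡ 0) → 2 ≤ a′ + suc t′
    2≤a+1+t (suc _) _       _       = ℕₚ.+-mono-≤ (s≤s z≤n) (s≤s z≤n)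
    2≤a+1+t zero    (suc _) _       = s≤s (s≤s z≤n)
    2≤a+1+t zero    zero    nontriv = ⊥-elim (nontriv (refl , refl))
    length-is : length (range 1 a ++ range b (suc t)) ≡ a + suc t
    length-is = trans (Listₚ.length-++ (range 1 a))
                      (≡.cong₂ _+_ (length-range 1 a) (length-range b (suc t)))
    bound : ∀ {i} → i ∈ₗ range 0 (suc a) ++ range b (suc t) → i < c
    bound {i} i∈ with ∈-++⁻ (range 0 (suc a)) i∈
    ... | inj₁ i∈₁ = ℕₚ.<-≤-trans (proj₂ (∈-range⁻ i∈₁)) a<c
    ... | inj₂ i∈₂ = subst (i <_) b+1+t≡c (proj₂ (∈-range⁻ i∈₂))

  no-chord : ∀ {a b} → a < b → b < c → Adj a b → b ≢ suc a → ¬ (a ≡ 0 × b ≡ ℓ) → ⊥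
  no-chord {a} {b} a<b b<c a~b b≢1+a not-long =
    1+a∉ (IndexCycle-spanning (shortcut a<b b+t≡ℓ a~b nontrivial) (ℕₚ.<-trans 1+a<b b<c))
    where
    t : ℕ
    t = proj₁ (ℕₚ.m≤n⇒∃[o]m+o≡n b<c)
    b+t≡ℓ : b + t ≡ ℓ
    b+t≡ℓ = ℕₚ.suc-injective (proj₂ (ℕₚ.m≤n⇒∃[o]m+o≡n b<c))
    nontrivial : ¬ (a ≡ 0 × t ≡ 0)
    nontrivial (a≡0 , t≡0) =
      not-long (a≡0 , trans (≡.sym (ℕₚ.+-identityʳ b)) (trans (cong (b +_) (≡.sym t≡0)) b+t≡ℓ))
    1+a<b : suc a < b
    1+a<b = ℕₚ.≤∧≢⇒< a<b (b≢1+a ∘ ≡.sym)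
    1+a∉ : suc a ∉ₗ range 0 (suc a) ++ range b (suc t)
    1+a∉ i∈ with ∈-++⁻ (range 0 (suc a)) i∈
    ... | inj₁ i∈₁ = ℕₚ.<-irrefl refl (proj₂ (∈-range⁻ i∈₁))
    ... | inj₂ i∈₂ = ℕₚ.<⇒≱ 1+a<b (proj₁ (∈-range⁻ i∈₂))

  chord : ∀ {a b} → a < b → b < c → Adj a b → b ≡ suc a ⊎ (a ≡ 0 × b ≡ ℓ)
  chord {a} {b} a<b b<c a~b with b ℕₚ.≟ suc a | a ℕₚ.≟ 0 ×-dec b ℕₚ.≟ ℓ
  ... | yes b≡1+a | _         = inj₁ b≡1+a
  ... | no _      | yes long  = inj₂ long
  ... | no b≢1+a  | no ¬long = ⊥-elim (no-chord a<b b<c a~b b≢1+a ¬long)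

  -- c, 0, 1, …, b is a cycle missing ℓ.
  ¬pendant-middle : ∀ {b} → 0 < b → b < ℓ → Adj c b → ⊥
  ¬pendant-middle {b} 0<b b<ℓ c~b = ∉cycle (IndexCycle-spanning cycle (ℕₚ.n<1+n ℓ))
    where
    in-range : ∀ {i} → i ∈ₗ range 0 (suc b) → i < ℓ
    in-range i∈ = ℕₚ.≤-<-trans (ℕₚ.≤-pred (proj₂ (∈-range⁻ i∈))) b<ℓ
    <ℓ⇒<c : ∀ {i} → i < ℓ → i < c
    <ℓ⇒<c = ℕₚ.m<n⇒m<1+n
    cycle : IndexCycle c (range 0 (suc b))
    cycle = subst (2 ≤_) (≡.sym (length-range 0 (suc b))) (s≤s 0<b) ,
            All.tabulate (λ i∈ → ℕₚ.<⇒≢ (<ℓ⇒<c (in-range i∈)) ∘ ≡.sym) ∷ Unique-range 0 (suc b) ,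
            c<n ∷ All.tabulate (<c⇒<n ∘ <ℓ⇒<c ∘ in-range) ,
            pendant ∷ Path-range-∷ʳ 0 b (λ j _ j<b → next j (<ℓ⇒<c (ℕₚ.≤-<-trans j<b b<ℓ))) (Adj-sym c~b)
    ∉cycle : ℓ ∉ₗ c ∷ range 0 (suc b)
    ∉cycle (here ℓ≡c)  = ℕₚ.1+n≢n (≡.sym ℓ≡c)
    ∉cycle (there ℓ∈) = ℕₚ.<-irrefl refl (in-range ℓ∈)

  -- c, ℓ, 0 is a cycle missing 1.
  ¬pendant-last : Adj c ℓ → ⊥
  ¬pendant-last c~ℓ = ∉cycle (IndexCycle-spanning cycle (s≤s (s≤s z≤n)))
    where
    cycle : IndexCycle c (ℓ ∷ 0 ∷ [])
    cycle = s≤s (s≤s z≤n) ,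
            (ℕₚ.1+n≢n ∷ (λ ()) ∷ []) ∷ ((λ ()) ∷ []) ∷ [] ∷ [] ,
            c<n ∷ <c⇒<n (ℕₚ.n<1+n ℓ) ∷ s≤s z≤n ∷ [] ,
            c~ℓ ∷ close ∷ Adj-sym pendant ∷ []
    ∉cycle : 1 ∉ₗ c ∷ ℓ ∷ 0 ∷ []
    ∉cycle (here ())
    ∉cycle (there (here ()))
    ∉cycle (there (there (here ())))

  pendant-neighbour : ∀ {b} → b < c → Adj c b → b ≡ 0
  pendant-neighbour {b} b<c c~b with b ℕₚ.≟ 0 | b ℕₚ.≟ ℓ
  ... | yes b≡0 | _        = b≡0
  ... | no _    | yes refl = ⊥-elim (¬pendant-last c~b)
  ... | no b≢0  | no b≢ℓ   = ⊥-elim (¬pendant-middle (ℕₚ.n≢0⇒n>0 b≢0) (ℕₚ.≤∧≢⇒< (ℕₚ.≤-pred b<c) b≢ℓ) c~b)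

  Adj⇒CpendEdge : ∀ {i j} → i < n → j < n → Adj i j → CpendEdge c i j
  Adj⇒CpendEdge {i} {j} i<n j<n i~j =
    i≢j , arcs (ℕₚ.m≤n⇒m<n∨m≡n (ℕₚ.≤-pred i<n)) (ℕₚ.m≤n⇒m<n∨m≡n (ℕₚ.≤-pred j<n))
    where
    i≢j : i ≢ j
    i≢j refl = adj⇒≢ G i~j refl
    arcs : i < c ⊎ i ≡ c → j < c ⊎ j ≡ c → Arc c i j ⊎ Arc c j i
    arcs (inj₁ i<c) (inj₁ j<c) with ℕₚ.<-cmp i j
    ... | tri< i<j _ _ = inj₁ (Sum.map (λ j≡1+i → ≡.sym j≡1+i , j<c) inj₁ (chord i<j j<c i~j))
    ... | tri≈ _ i≡j _ = ⊥-elim (i≢j i≡j)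
    ... | tri> _ _ j<i = inj₂ (Sum.map (λ i≡1+j → ≡.sym i≡1+j , i<c) inj₁ (chord j<i i<c (Adj-sym i~j)))
    arcs (inj₁ i<c)  (inj₂ refl) = inj₁ (inj₂ (inj₂ (pendant-neighbour i<c (Adj-sym i~j) , refl)))
    arcs (inj₂ refl) (inj₁ j<c)  = inj₂ (inj₂ (inj₂ (pendant-neighbour j<c i~j , refl)))
    arcs (inj₂ refl) (inj₂ refl) = ⊥-elim (i≢j refl)

  Arc⇒Adj : ∀ {i j} → Arc c i j → Adj i j
  Arc⇒Adj (inj₁ (refl , j<c))          = next _ j<c
  Arc⇒Adj (inj₂ (inj₁ (refl , refl))) = Adj-sym close
  Arc⇒Adj (inj₂ (inj₂ (refl , refl))) = Adj-sym pendant

  CpendEdge⇒Adj : ∀ {i j} → CpendEdge c i j → Adj i j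
  CpendEdge⇒Adj (_ , inj₁ arc) = Arc⇒Adj arc
  CpendEdge⇒Adj (_ , inj₂ arc) = Adj-sym (Arc⇒Adj arc)

  G≅Cpend : G ≅ Cpend n
  G≅Cpend = toFin , λ x y → begin
    adj G x y
      ≡⟨ ≡-does (to x y) (from x y) (CpendEdge? c (index x) (index y)) ⟩
    does (CpendEdge? c (index x) (index y))
      ≡⟨ ≡.cong₂ (λ i j → does (CpendEdge? c i j)) (toℕ-toFin x) (toℕ-toFin y) ⟨
    Cpend n (Inverse.to toFin x) (Inverse.to toFin y)
      ∎
    where
    open ≡.≡-Reasoning
    relabel : ∀ x y → adj G x y ≡ adj G (vertex (index x)) (vertex (index y))
    relabel x y = ≡.cong₂ (adj G) (≡.sym (vertex-index x)) (≡.sym (vertex-index y))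
    to : ∀ x y → adj G x y ≡ true → CpendEdge c (index x) (index y)
    to x y e = Adj⇒CpendEdge (index<n x) (index<n y) (trans (≡.sym (relabel x y)) e)
    from : ∀ x y → CpendEdge c (index x) (index y) → adj G x y ≡ true
    from x y edge = trans (relabel x y) (CpendEdge⇒Adj edge)

-- E-independent sets of size n - 1

module LargeEIndependentSet (k : ℕ) (G : Graph (4 + k)) (conn : Connected G)
  (S : Subset (4 + k)) (∣S∣≡ : ∣ S ∣ ≡ 3 + k) (p w : Fin (4 + k))
  (p∈S : p ∈ S) (w∈⟨S-p⟩ : InHull G (S - p) w) (separated : ∀ a → a ∈ S → a ≢ p → ¬ InHull G (S - a) w)
  where

  open CpendOrder k
  open Cycles G
  open Hull G
  open EIndependence G
  open import Data.List.Membership.DecPropositional (Finₚ._≟_ {n}) using () renaming (_∈?_ to _∈ₗ?_)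

  w∉S : w ∉ S
  w∉S = ExchangeWitness-∉ (subst (3 ≤_) (≡.sym ∣S∣≡) (s≤s (s≤s (s≤s z≤n)))) (p∈S , w∈⟨S-p⟩ , separated)

  ≢w⇒∈S : ∀ {x} → x ≢ w → x ∈ S
  ≢w⇒∈S {x} x≢w = decidable-stable (x ∈? S) λ x∉S →
    ℕₚ.<-irrefl (trans (∣⁅x⁆∣≡1 w) (≡.sym ∣∁S∣≡1)) (p⊂q⇒∣p∣<∣q∣ (⁅w⁆⊂∁S x∉S))
    where
    ∣∁S∣≡1 : ∣ ∁ S ∣ ≡ 1
    ∣∁S∣≡1 = trans (∣∁p∣≡n∸∣p∣ S) (trans (cong (n ∸_) ∣S∣≡) (ℕₚ.m+n∸n≡m 1 k))
    ⁅w⁆⊂∁S : x ∉ S → ⁅ w ⁆ ⊂ ∁ S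
    ⁅w⁆⊂∁S x∉S = (λ z∈⁅w⁆ → x∉p⇒x∈∁p (subst (_∉ S) (≡.sym (x∈⁅y⁆⇒x≡y w z∈⁅w⁆)) w∉S)) ,
                 x , x∉p⇒x∈∁p x∉S , x≢y⇒x∉⁅y⁆ x≢w

  p≢w : p ≢ w
  p≢w p≡w = w∉S (subst (_∈ S) p≡w p∈S)

  -- Otherwise a vertex b ≢ p of the cycle lies in ⟨S - b⟩, hence S - p ⊆ ⟨S - b⟩ and w ∈ ⟨S - b⟩.
  cycle∋w : ∀ {v xs} → IsCycle v xs → w ∈ₗ v ∷ xs
  cycle∋w {v} {xs} cyc = decidable-stable (w ∈ₗ? v ∷ xs) avoids-w
    where
    avoids-w : w ∉ₗ v ∷ xs → ⊥
    avoids-w w∉cyc = separated b (≢w⇒∈S (≢w b∈cyc)) b≢p (InHull-trans S-p⊆⟨S-b⟩ w∈⟨S-p⟩)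
      where
      ≢w : ∀ {z} → z ∈ₗ v ∷ xs → z ≢ w
      ≢w z∈cyc z≡w = w∉cyc (subst (_∈ₗ _) z≡w z∈cyc)
      off-p : ∃[ b ] (b ∈ₗ v ∷ xs × b ≢ p)
      off-p with v Finₚ.≟ p | IsCycle-≢ cyc
      ... | no v≢p  | _                  = v , here refl , v≢p
      ... | yes v≡p | x , x∈xs , x≢v = x , there x∈xs , λ x≡p → x≢v (trans x≡p (≡.sym v≡p))
      b = proj₁ off-p
      b∈cyc = proj₁ (proj₂ off-p)
      b≢p = proj₂ (proj₂ off-p)
      b∈⟨S-b⟩ : InHull G (S - b) b
      b∈⟨S-b⟩ = on-cycle⇒InHull cyc b∈cyc λ z∈cyc z≢b → ∈⇒InHull (x∈p∧x≢y⇒x∈p-y (≢w⇒∈S (≢w z∈cyc)) z≢b)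
      S-p⊆⟨S-b⟩ : ∀ {z} → z ∈ S - p → InHull G (S - b) z
      S-p⊆⟨S-b⟩ {z} z∈S-p with z Finₚ.≟ b
      ... | yes refl = b∈⟨S-b⟩
      ... | no z≢b   = ∈⇒InHull (x∈p∧x≢y⇒x∈p-y (p─q⊆p S ⁅ p ⁆ z∈S-p) z≢b)

  -- Otherwise the cycle, which contains w, puts w into ⟨S - a⟩.
  cycle∋-≢p : ∀ {v xs} → IsCycle v xs → ∀ {a} → a ≢ p → a ∈ₗ v ∷ xs
  cycle∋-≢p {v} {xs} cyc {a} a≢p = decidable-stable (a ∈ₗ? v ∷ xs) λ a∉cyc →
    separated a (≢w⇒∈S (a≢w a∉cyc)) a≢p (on-cycle⇒InHull cyc (cycle∋w cyc) λ z∈cyc z≢w →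
      ∈⇒InHull (x∈p∧x≢y⇒x∈p-y (≢w⇒∈S z≢w) λ z≡a → a∉cyc (subst (_∈ₗ _) z≡a z∈cyc)))
    where
    a≢w : a ∉ₗ v ∷ xs → a ≢ w
    a≢w a∉cyc refl = a∉cyc (cycle∋w cyc)

  cycle-avoiding-p : ∃[ xs ] (IsCycle w xs × p ∉ₗ w ∷ xs)
  cycle-avoiding-p = from-interval (¬CycleConvex⇒InCycleInterval (InHull⇒¬CycleConvex w∈⟨S-p⟩ w∉S-p))
    where
    w∉S-p : w ∉ S - p
    w∉S-p = w∉S ∘ p─q⊆p S ⁅ p ⁆
    from-interval : ∃[ v ] InCycleInterval G (S - p) v → ∃[ xs ] (IsCycle w xs × p ∉ₗ w ∷ xs)
    from-interval (v , _ , ct) with CycleThroughIn⇒IsCycle ct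
    ... | xs , cyc , inU = go (is-v (cycle∋w cyc) w∉S-p)
      where
      is-v : ∀ {z} → z ∈ₗ v ∷ xs → z ∉ S - p → z ≡ v
      is-v z∈cyc = x∈p∪⁅y⁆∧x∉p⇒x≡y (All.lookup inU z∈cyc)
      go : w ≡ v → ∃[ ys ] (IsCycle w ys × p ∉ₗ w ∷ ys)
      go refl = xs , cyc , λ p∈cyc → p≢w (is-v p∈cyc (λ p∈S-p → x∈p-y⇒x≢y p∈S-p refl))

  neighbour : ∃[ y ] adj G p y ≡ true
  neighbour = Connected⇒neighbour G conn p≢w

  y : Fin n
  y = proj₁ neighbour

  p~y : adj G p y ≡ true
  p~y = proj₂ neighbour

  y≢p : y ≢ p
  y≢p = adj⇒≢ G p~y ∘ ≡.sym

  rotated : ∃[ ys ] (IsCycle y ys × w ∷ proj₁ cycle-avoiding-p ↭ y ∷ ys)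
  rotated = IsCycle-rotate cyc₀ (cycle∋-≢p cyc₀ y≢p)
    where cyc₀ = proj₁ (proj₂ cycle-avoiding-p)

  L : List (Fin n)
  L = y ∷ proj₁ rotated

  cycle-L : IsCycle y (proj₁ rotated)
  cycle-L = proj₁ (proj₂ rotated)

  p∉L : p ∉ₗ L
  p∉L = proj₂ (proj₂ cycle-avoiding-p) ∘ ∈-resp-↭ (↭-sym (proj₂ (proj₂ rotated)))

  -- Labelling the cycle y, … by 0, …, ℓ and p by c makes p adjacent to 0.
  F : List (Fin n)
  F = L ++ [ p ]

  F-unique : Unique F
  F-unique = Uniqueₚ.++⁺ (proj₁ (proj₂ cycle-L)) ([] ∷ []) λ { (p∈L , here refl) → p∉L p∈L }

  F-complete : ∀ x → x ∈ₗ F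
  F-complete x = by-cases (x Finₚ.≟ p)
    where
    by-cases : Dec (x ≡ p) → x ∈ₗ F
    by-cases (yes refl) = ∈-++⁺ʳ L (here refl)
    by-cases (no x≢p)   = ∈-++⁺ˡ (cycle∋-≢p cycle-L x≢p)

  open Enumeration p F F-unique F-complete
  open Labelling labelling
  open Labelled G labelling


  length-L : length L ≡ c
  length-L =
    ℕₚ.suc-injective (trans (ℕₚ.+-comm 1 (length L)) (trans (≡.sym (Listₚ.length-++ L)) length≡n))

  length-L++[_] : ∀ z → length (L ++ [ z ]) ≡ n
  length-L++[ z ] = trans (Listₚ.length-++ L) (trans (ℕₚ.+-comm (length L) 1) (cong suc length-L))

  vertex-L : ∀ {j} z → j < c → nth p (L ++ [ z ]) j ≡ vertex j
  vertex-L {j} z j<c = trans (nth-++ˡ p L [ z ] j<length) (≡.sym (nth-++ˡ p L [ p ] j<length))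
    where
    j<length : j < length L
    j<length = subst (j <_) (≡.sym length-L) j<c

  nth-last : ∀ z → nth p (L ++ [ z ]) c ≡ z
  nth-last z = trans (cong (nth p (L ++ [ z ])) (≡.sym length-L)) (nth-++-length p L z [])

  L-edge : ∀ {i} → suc i < n → adj G (nth p (L ++ [ y ]) i) (nth p (L ++ [ y ]) (suc i)) ≡ true
  L-edge {i} 1+i<n =
    Chain-nth p (proj₂ (proj₂ cycle-L)) (subst (suc i <_) (≡.sym (length-L++[ y ])) 1+i<n)

  next : ∀ i → suc i < c → Adj i (suc i)
  next i 1+i<c = ≡.subst₂ (λ u v → adj G u v ≡ true)
    (vertex-L y (ℕₚ.<-trans (ℕₚ.n<1+n i) 1+i<c)) (vertex-L y 1+i<c) (L-edge (ℕₚ.m<n⇒m<1+n 1+i<c))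

  close : Adj (2 + k) 0
  close = ≡.subst₂ (λ u v → adj G u v ≡ true) (vertex-L y (ℕₚ.n<1+n _)) (nth-last y) (L-edge c<n)

  pendant : Adj c 0
  pendant = subst (λ u → adj G u y ≡ true) (≡.sym (nth-last p)) p~y

  spanning : ∀ {v xs} → IsCycle v xs → ∀ {j} → j < c → vertex j ∈ₗ v ∷ xs
  spanning cyc {j} j<c = cycle∋-≢p cyc λ vj≡p →
    ℕₚ.<⇒≢ j<c (vertex-injective (<c⇒<n j<c) c<n (trans vj≡p (≡.sym (nth-last p))))

  G≅Cpend : G ≅ Cpend n
  G≅Cpend = CpendRecognition.G≅Cpend k G labelling next close pendant spanning

≅⇒≤ : ∀ {n m} (G : Graph n) (A : Fin m → Fin m → Bool) → G ≅ A → n ≤ m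
≅⇒≤ _ _ (σ , _) = Finₚ.injective⇒≤ (Injection.injective (↔⇒↣ σ))

theorem2 : (n : ℕ) → 3 ≤ n → (G : Graph n) → Connected G →
    ExchangeNumber G (n ∸ 1) ⇔ (G ≅ K₃ ⊎ G ≅ P₃ ⊎ (3 ≤ n ∸ 1 × G ≅ Cpend n))
theorem2 zero                   ()                      _ _
theorem2 (suc zero)             (s≤s ())                _ _
theorem2 (suc (suc zero))       (s≤s (s≤s ()))          _ _
theorem2 (suc (suc (suc zero))) _ G conn =
  mk⇔ (λ _ → Sum.map₂ inj₁ (Connected-3 G conn)) (λ _ → ExchangeNumber-3 G)
theorem2 (suc (suc (suc (suc k)))) _ G conn = mk⇔ forward backward
  where
  forward : ExchangeNumber G (3 + k) → G ≅ K₃ ⊎ G ≅ P₃ ⊎ (3 ≤ 3 + k × G ≅ Cpend (4 + k))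
  forward ((_ , (_ , inj₁ ∣S∣≡1) , ∣S∣≡3+k) , _) with trans (≡.sym ∣S∣≡1) ∣S∣≡3+k
  ... | ()
  forward ((S , (_ , inj₂ (p , w , p∈S , w∈⟨S-p⟩ , separated)) , ∣S∣≡3+k) , _) =
    inj₂ (inj₂ (s≤s (s≤s (s≤s z≤n)) ,
                LargeEIndependentSet.G≅Cpend k G conn S ∣S∣≡3+k p w p∈S w∈⟨S-p⟩ separated))
  backward : G ≅ K₃ ⊎ G ≅ P₃ ⊎ (3 ≤ 3 + k × G ≅ Cpend (4 + k)) → ExchangeNumber G (3 + k)
  backward (inj₁ G≅K₃)             with ≅⇒≤ G K₃ G≅K₃
  ... | s≤s (s≤s (s≤s ()))
  backward (inj₂ (inj₁ G≅P₃))      with ≅⇒≤ G P₃ G≅P₃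
  ... | s≤s (s≤s (s≤s ()))
  backward (inj₂ (inj₂ (_ , G≅))) = CpendExchangeNumber.exchangeNumber k G G≅
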